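{- Let $\mathcal B=\mathcal B_1,\mathcal B_2,\ldots$ be the sequence of even binary partitions defined in the context. Let $P$ be a term of $\mathcal B$, and for $k\ge1$ let $d_k$ be the number of parts of $P$ equal to $2^k$. Let $i$ be the largest $k\ge1$ with $d_k>0$ ($i=0$ if $P=\emptyset$); let $j$ be the largest $k$ with $1\le k<i$ and $d_k>0$ ($j=0$ if there is none); let $\epsilon=(-1)^{d_1+d_2+\cdots+d_{i-1}}$. The digit $d_0$ is not a part count of $P$: it stands for an unlimited supply of parts equal to $1$ and is regarded as an even integer $\ge 2$ (in particular, when $j=0$ the condition $d_j=1$ fails). Define the following six operations on the digit vector $(d_k)_{k\ge0}$, after which all parts equal to $1$ are discarded (so a change of $d_0$ has no effect on the resulting partition): (a) if $d_i=1$ and $\epsilon=-\sigma$: decrease $d_i$ by $1$ and increase $d_{i-1}$ by $2$ (split a largest part); (b) if $d_i$ is odd, $d_i\neq 1$, and $\epsilon=-\sigma$: increase $d_{i+1}$ by $1$ and decrease $d_i$ by $2$ (merge two largest parts); (c) if $d_i$ is odd, $d_j=1$, and $\epsilon=\sigma$: decrease $d_j$ by $1$ and increase $d_{j-1}$ by $2$ (split a second-largest part); (d) if $d_i$ is odd, $d_j\neq1$, and $\epsilon=\sigma$: increase $d_{j+1}$ by $1$ and decrease $d_j$ by $2$ (merge two second-largest parts); (e) if $d_i$ is even and $\epsilon=-\sigma$: decrease $d_i$ by $1$ and increase $d_{i-1}$ by $2$ (split a largest part); (f) if $d_i$ is even and $\epsilon=\sigma$: increase $d_{i+1}$ by $1$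 and decrease $d_i$ by $2$ (merge two largest parts). Then: taking $\sigma=+1$, the applicable operation transforms $P$ into its successor in $\mathcal B$; and if $P\neq\mathcal B_1$, taking $\sigma=-1$, the applicable operation transforms $P$ into its predecessor in $\mathcal B$.
   Context: A binary partition of $n\ge0$ is a multiset of powers of two ($1,2,4,\dots$) summing to $n$; $\emptyset$ is the unique binary partition of $0$. Let $b(n)$ be the number of binary partitions of $n$. For a partition $P$, $P+1$ denotes $P$ with an extra part $1$ added, and $2\times P$ denotes $P$ with every part doubled. Define ordered lists $\mathcal B(n)$ of all binary partitions of $n$ recursively: $\mathcal B(0)=(\emptyset)$; for $n\ge1$: - if $n$ is odd, $\mathcal B(n)$ is the list $(Q+1)$ for $Q$ running through $\mathcal B(n-1)$ in order; - if $n\equiv0\pmod 4$, $\mathcal B(n)$ is the list $(Q+1)$ for $Q$ running through $\mathcal B(n-1)$ in order, followed by $(2\times Q)$ for $Q$ running through $\mathcal B(n/2)$ in order; - if $n\equiv2\pmod 4$, $\mathcal B(n)$ is the list $(Q+1)$ for $Q$ running through $\mathcal B(n-1)$ in order, followed by $(2\times Q)$ for $Q$ running through $\mathcal B(n/2)$ in reverse order. An even binary partition is a binary partition with no part equal to $1$. The infinite sequence $\mathcal B=\mathcal B_1,\mathcal B_2,\dots$ is the concatenation, over $n=0,2,4,6,\dots$ in increasing order, of the blocks: for $n=0$ the single term $\emptyset$; for even $n\ge2$ the terms of $\mathcal B(n)$ having no part equal to $1$ (these are its last $b(n/2)$ terms), in the order they occur in $\mathcal B(n)$. Thus $\mathcal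 B_1=\emptyset$ and $\mathcal B$ lists every even binary partition exactly once. -}

module Defs where

open import Data.Bool using (Bool; true; false; if_then_else_; not)
open import Data.Nat using (ℕ; zero; suc; _+_; _*_; _∸_; _⊔_; _≡ᵇ_; _≤ᵇ_; _<ᵇ_)
open import Data.Nat.DivMod using (_/_; _%_)
open import Data.List using (List; []; _∷_; [_]; _++_; map; reverse; filterᵇ; length; foldr; concatMap; upTo; drop)
open import Data.Sign using (Sign; opposite) renaming (+ to plus; - to minus)

-- A binary partition is represented by the list of the EXPONENTS of its
-- parts (part 2^e is stored as e), in non-increasing order.  All
-- partitions produced below are in this canonical form.

Partition : Set
Partition = List ℕ

addOne : Partition → Partition
addOne P = P ++ [ 0 ]

double : Partition → Partition
double P = map suc P

-- The ordered lists 𝓑(n), by recursion with fuel (fuel n+1 suffices,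
-- since each recursive call decreases the argument n ≥ 1 to n-1 or n/2).
Bfuel : ℕ → ℕ → List Partition
Bfuel zero    _       = []
Bfuel (suc f) zero    = [ [] ]
Bfuel (suc f) (suc m) =
  if (suc m % 2) ≡ᵇ 1
    then ones
    else (if (suc m % 4) ≡ᵇ 0
            then ones ++ map double (Bfuel f (suc m / 2))
            else ones ++ map double (reverse (Bfuel f (suc m / 2))))
  where
    ones : List Partition
    ones = map addOne (Bfuel f m)

𝓑list : ℕ → List Partition
𝓑list n = Bfuel (suc n) n

hasOne : Partition → Bool
hasOne []      = false
hasOne (e ∷ P) = if e ≡ᵇ 0 then true else hasOne P

-- the block of the sequence 𝓑 coming from 𝓑(2m): its even partitions,
-- in the order in which they occur in 𝓑(2m)
block : ℕ → List Partition
block m = filterᵇ (λ P → not (hasOne P)) (𝓑list (2 * m))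

prefix : ℕ → List Partition
prefix t = concatMap block (upTo (suc t))

nthOr : {A : Set} → A → List A → ℕ → A
nthOr d []      _       = d
nthOr d (x ∷ _) zero    = x
nthOr d (_ ∷ xs) (suc n) = nthOr d xs n

-- The infinite sequence 𝓑 = 𝓑₁, 𝓑₂, ... (1-based: 𝓑seq 1 = ∅).
-- Each block is nonempty, so prefix t has length ≥ t+1 and the default
-- value is never actually used for t ≥ 1.
𝓑seq : ℕ → Partition
𝓑seq t = nthOr [] (prefix t) (t ∸ 1)

count : ℕ → Partition → ℕ
count k P = length (filterᵇ (λ e → e ≡ᵇ k) P)

-- digit vector: d_k for k ≥ 1 is a part count; d_0 stands for an
-- unlimited supply of 1's and is taken to be the even number 2 ≥ 2
-- (only its parity, its being ≠ 1 and its being ≥ 2 matter).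
Digits : Set
Digits = ℕ → ℕ

digits : Partition → Digits
digits P zero    = 2
digits P (suc k) = count (suc k) P

topExp : Partition → ℕ
topExp P = foldr _⊔_ 0 (filterᵇ (λ e → 1 ≤ᵇ e) P)

below : Partition → List ℕ
below P = filterᵇ (λ e → (1 ≤ᵇ e) Data.Bool.∧ (e <ᵇ topExp P)) P
  where import Data.Bool

secondExp : Partition → ℕ
secondExp P = foldr _⊔_ 0 (below P)

epsilon : Partition → Sign
epsilon P = if (length (below P) % 2) ≡ᵇ 0 then plus else minus

isOdd : ℕ → Bool
isOdd n = (n % 2) ≡ᵇ 1

signEq : Sign → Sign → Bool
signEq plus  plus  = true
signEq minus minus = true
signEq _     _     = false

split : ℕ → Digits → Digits
split p D k = (D k + (if k ≡ᵇ (p ∸ 1) then 2 else 0)) ∸ (if k ≡ᵇ p then 1 else 0)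

merge : ℕ → Digits → Digits
merge p D k = (D k + (if k ≡ᵇ suc p then 1 else 0)) ∸ (if k ≡ᵇ p then 2 else 0)

-- the applicable operation (a)–(f) for the sign σ, acting on the digit
-- vector of P (parts equal to 1, i.e. d_0, are afterwards discarded:
-- only the digits k ≥ 1 of the result are meaningful)
operation : Sign → Partition → Digits
operation σ P =
  if signEq ε (opposite σ)
    then (if di ≡ᵇ 1 then split i D
          else if isOdd di then merge i D
          else split i D)
    else (if isOdd di
            then (if dj ≡ᵇ 1 then split j D
                  else merge j D)
            else merge i D)
  where
    D  = digits P
    i  = topExp P
    j  = secondExp P
    ε  = epsilon P
    di = D i
    dj = D j

-- Each σ-operation changes the multiplicities by a single move: it splits one part 2^p into two
-- parts 2^(p-1), or merges two parts 2^p into one. The even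
-- partitions of 𝓑(2n) are the doubles of 𝓑(n), in order or reversed, and 𝓑(n) lists 𝓑(n - 1) with a
-- part 1 added, followed for even n by the doubles of 𝓑(n / 2). Doubling a partition moves the
-- selected split or merge one exponent up, and adding a part 2 below the largest part flips ε and so
-- exchanges the two directions; hence, as long as the moves never touch parts equal to 1, the doubles
-- of consecutive terms of 𝓑(n) are related by the moves of direction (-1)^n. What remains are the
-- seams, where the two halves of 𝓑(n) meet and where consecutive blocks of 𝓑 meet: there the two
-- partitions are an odd number of equal parts above either two 2s or one 4, or above either nothing
-- or one 2, and the moves are computed directly.
module Submission where

open import Data.Bool using (Bool; true; false; if_then_else_; not; _∧_; T)
open import Data.Bool.Properties using (T?)
open import Data.List
  using (List; []; _∷_; [_]; _++_; map; reverse; replicate; filterᵇ; length; foldr; head; last; concatMap; upTo)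
open import Data.List.Properties
  using ( applyUpTo-∷ʳ; concatMap-++; filter-++; filter-all; filter-none; length-++; length-map; length-replicate
        ; map-++; map-∘; map-replicate; reverse-involutive; reverse-map; unfold-reverse; ++-assoc; ++-identityʳ)
open import Data.List.Relation.Unary.All as All using (All; []; _∷_)
import Data.List.Relation.Unary.All.Properties as All
open import Data.List.Relation.Unary.Linked using (Linked; []; [-]; _∷_)
import Data.List.Relation.Unary.Linked as Linked
import Data.List.Relation.Unary.Linked.Properties as Linked
open import Data.Maybe using (just)
open import Data.Maybe.Relation.Binary.Connected using (Connected; just; just-nothing; nothing-just)
open import Data.Nat using (ℕ; zero; suc; pred; _+_; _*_; _∸_; _⊔_; _≤_; _<_; _≡ᵇ_; _≤ᵇ_; _<ᵇ_; z≤n; s≤s)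
open import Data.Nat.DivMod using (_/_; _%_; m/n<m; m*n%n≡0; m*n/n≡m; [m+kn]%n≡m%n)
open import Data.Nat.Induction using (<-rec)
open import Data.Nat.Properties
  using ( ≤-refl; ≤-trans; n<1+n; n≤1+n; m≤m+n; m≤n+m; m<m*n; <⇒≤; <⇒≢; n≮n; +-mono-≤
        ; ≤⇒≤ᵇ; <⇒<ᵇ; <ᵇ⇒<; ≡⇒≡ᵇ; ≡ᵇ⇒≡; ⊔-lub; ⊔-idem; ⊔-identityʳ; ⊔-assoc; m≥n⇒m⊔n≡m
        ; +-assoc; +-comm; +-identityʳ; +-∸-assoc; *-assoc; *-comm)
open import Data.Product using (∃-syntax; _×_; _,_; proj₁; proj₂)
open import Data.Sign using (Sign; opposite) renaming (+ to plus; - to minus)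
open import Data.Sign.Properties using (opposite-involutive)
open import Data.Unit using (tt)
open import Function using (_∘_; flip; id)
open import Relation.Binary.PropositionalEquality
  using (_≡_; _≢_; refl; sym; trans; cong; cong₂; subst; subst₂; module ≡-Reasoning)

open import Defs

module _ {A B : Set} (f : A → B) where

  head-map-just : ∀ xs {x} → head xs ≡ just x → head (map f xs) ≡ just (f x)
  head-map-just (_ ∷ _) refl = refl

  last-map-just : ∀ xs {x} → last xs ≡ just x → last (map f xs) ≡ just (f x)
  last-map-just (_ ∷ [])     refl = refl
  last-map-just (_ ∷ y ∷ xs) eq   = last-map-just (y ∷ xs) eq

module _ {A : Set} where

  head-++ : ∀ {x : A} xs ys → head xs ≡ just x → head (xs ++ ys) ≡ just x
  head-++ (_ ∷ _) ys eq = eq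

  last-++-∷ : ∀ (xs : List A) y ys → last (xs ++ y ∷ ys) ≡ last (y ∷ ys)
  last-++-∷ []           y ys = refl
  last-++-∷ (x ∷ [])     y ys = refl
  last-++-∷ (x ∷ z ∷ xs) y ys = last-++-∷ (z ∷ xs) y ys

  last-++ʳ : ∀ (xs : List A) {ys y} → last ys ≡ just y → last (xs ++ ys) ≡ just y
  last-++ʳ xs {ys = z ∷ ys} eq = trans (last-++-∷ xs z ys) eq

  last-reverse : ∀ (xs : List A) → last (reverse xs) ≡ head xs
  last-reverse []       = refl
  last-reverse (x ∷ xs) = trans (cong last (unfold-reverse x xs)) (last-++-∷ (reverse xs) x [])

  head-reverse : ∀ (xs : List A) → head (reverse xs) ≡ last xs
  head-reverse xs = trans (sym (last-reverse (reverse xs))) (cong last (reverse-involutive xs))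

  replicate-∷ʳ : ∀ n (x : A) → replicate n x ++ [ x ] ≡ replicate (suc n) x
  replicate-∷ʳ zero    x = refl
  replicate-∷ʳ (suc n) x = cong (x ∷_) (replicate-∷ʳ n x)

filterᵇ-map : ∀ {A B : Set} (p : B → Bool) (f : A → B) xs →
              filterᵇ p (map f xs) ≡ map f (filterᵇ (λ x → p (f x)) xs)
filterᵇ-map p f []       = refl
filterᵇ-map p f (x ∷ xs) with p (f x)
... | true  = cong (f x ∷_) (filterᵇ-map p f xs)
... | false = filterᵇ-map p f xs

filterᵇ-true : ∀ {A : Set} (xs : List A) → filterᵇ (λ _ → true) xs ≡ xs
filterᵇ-true xs = filter-all (λ _ → T? true) (All.universal (λ _ → tt) xs)

module _ {A : Set} {R : A → A → Set} where

  connect : ∀ xs ys {x y} → last xs ≡ just x → head ys ≡ just y → R x y →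
            Connected R (last xs) (head ys)
  connect _ _ eq₁ eq₂ r rewrite eq₁ | eq₂ = just r

  Linked-reverse : ∀ {xs} → Linked R xs → Linked (flip R) (reverse xs)
  Linked-reverse {[]}     _ = []
  Linked-reverse {x ∷ xs} l =
    subst (Linked (flip R)) (sym (unfold-reverse x xs))
          (Linked.++⁺ (Linked-reverse (Linked.tail l))
                      (subst (λ m → Connected (flip R) m (just x)) (sym (last-reverse xs)) (swap (Linked.head′ l)))
                      [-])
    where
    swap : ∀ {m} → Connected R (just x) m → Connected (flip R) m (just x)
    swap (just r)     = just r
    swap just-nothing = nothing-just

module _ {A : Set} (d : A) where

  nthOr-++ : ∀ xs ys i → i < length xs → nthOr d (xs ++ ys) i ≡ nthOr d xs i
  nthOr-++ (x ∷ xs) ys zero    _         = refl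
  nthOr-++ (x ∷ xs) ys (suc i) (s≤s i<n) = nthOr-++ xs ys i i<n

  Linked-nthOr : ∀ {R : A → A → Set} {xs} i → Linked R xs → suc i < length xs →
                 R (nthOr d xs i) (nthOr d xs (suc i))
  Linked-nthOr zero    (r ∷ _)  _          = r
  Linked-nthOr (suc i) (_ ∷ rs) (s≤s i<n)  = Linked-nthOr i rs i<n
  Linked-nthOr zero    [-]      (s≤s ())

data EvenOrOdd : ℕ → Set where
  even : ∀ m → EvenOrOdd (m * 2)
  odd  : ∀ m → EvenOrOdd (suc (m * 2))

evenOrOdd : ∀ n → EvenOrOdd n
evenOrOdd zero = even 0
evenOrOdd (suc n) with evenOrOdd n
... | even m = odd m
... | odd m  = even (suc m)

odd%2 : ∀ m → suc (m * 2) % 2 ≡ 1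
odd%2 m = [m+kn]%n≡m%n 1 m 2

even%2 : ∀ m → m * 2 % 2 ≡ 0
even%2 m = m*n%n≡0 m 2

isOdd-odd : ∀ m → isOdd (suc (m * 2)) ≡ true
isOdd-odd m = cong (_≡ᵇ 1) (odd%2 m)

isOdd-even : ∀ m → isOdd (m * 2) ≡ false
isOdd-even m = cong (_≡ᵇ 1) (even%2 m)

isOdd-suc : ∀ n → isOdd (suc n) ≡ not (isOdd n)
isOdd-suc n with evenOrOdd n
... | even m rewrite isOdd-odd m | isOdd-even m = refl
... | odd m  rewrite isOdd-even (suc m) | isOdd-odd m = refl

positive⇒≡ᵇ0-false : ∀ {d} → 1 ≤ d → (d ≡ᵇ 0) ≡ false
positive⇒≡ᵇ0-false (s≤s _) = refl

signOf : ℕ → Sign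
signOf l = if (l % 2) ≡ᵇ 0 then plus else minus

signOf-suc : ∀ l → signOf (suc l) ≡ opposite (signOf l)
signOf-suc l with evenOrOdd l
... | even m rewrite odd%2 m | even%2 m = refl
... | odd m  rewrite even%2 (suc m) | odd%2 m = refl

signEq-opposite : ∀ ε σ → signEq (opposite ε) (opposite (opposite σ)) ≡ signEq ε (opposite σ)
signEq-opposite plus  plus  = refl
signEq-opposite plus  minus = refl
signEq-opposite minus plus  = refl
signEq-opposite minus minus = refl

-- The recursion of 𝓑(n)

⌊1+m/2⌋<1+m : ∀ m → suc m / 2 < suc m
⌊1+m/2⌋<1+m m = m/n<m (suc m) 2 (s≤s (s≤s z≤n))

Bfuel-irrelevant : ∀ f g n → n < f → n < g → Bfuel f n ≡ Bfuel g n
Bfuel-irrelevant (suc f) (suc g) zero    _       _       = refl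
Bfuel-irrelevant (suc f) (suc g) (suc m) (s≤s p) (s≤s q)
  rewrite Bfuel-irrelevant f g m (≤-trans (n<1+n m) p) (≤-trans (n<1+n m) q)
        | Bfuel-irrelevant f g (suc m / 2) (≤-trans (⌊1+m/2⌋<1+m m) p) (≤-trans (⌊1+m/2⌋<1+m m) q) = refl

recurrence : ℕ → ℕ → List Partition → List Partition → List Partition
recurrence r₂ r₄ previous halves =
  if r₂ ≡ᵇ 1 then map addOne previous
  else if r₄ ≡ᵇ 0 then map addOne previous ++ map double halves
  else map addOne previous ++ map double (reverse halves)

𝓑list-suc : ∀ m → 𝓑list (suc m) ≡ recurrence (suc m % 2) (suc m % 4) (𝓑list m) (𝓑list (suc m / 2))
𝓑list-suc m =
  cong (recurrence (suc m % 2) (suc m % 4) (𝓑list m)) (Bfuel-irrelevant _ _ _ (⌊1+m/2⌋<1+m m) ≤-refl)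

recurrence-cong : ∀ {r₂ s₂ r₄ s₄ previous h h′} → r₂ ≡ s₂ → r₄ ≡ s₄ → h ≡ h′ →
                  recurrence r₂ r₄ previous (𝓑list h) ≡ recurrence s₂ s₄ previous (𝓑list h′)
recurrence-cong refl refl refl = refl

𝓑list-odd : ∀ m → 𝓑list (suc (m * 2)) ≡ map addOne (𝓑list (m * 2))
𝓑list-odd m = trans (𝓑list-suc (m * 2))
  (cong (λ r → recurrence r (suc (m * 2) % 4) (𝓑list (m * 2)) (𝓑list (suc (m * 2) / 2))) (odd%2 m))

𝓑list-4[1+m] : ∀ m → 𝓑list (suc m * 2 * 2) ≡
           map addOne (𝓑list (suc (suc (suc (m * 2 * 2))))) ++ map double (𝓑list (suc m * 2))
𝓑list-4[1+m] m = trans (𝓑list-suc (suc (suc (suc (m * 2 * 2)))))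
  (recurrence-cong (m*n%n≡0 (suc m * 2) 2)
                   (trans (cong (_% 4) (*-assoc (suc m) 2 2)) (m*n%n≡0 (suc m) 4))
                   (m*n/n≡m (suc m * 2) 2))

𝓑list-2[1+2m] : ∀ m → 𝓑list (suc (m * 2) * 2) ≡
           map addOne (𝓑list (suc (m * 2 * 2))) ++ map double (reverse (𝓑list (suc (m * 2))))
𝓑list-2[1+2m] m = trans (𝓑list-suc (suc (m * 2 * 2)))
  (recurrence-cong (m*n%n≡0 (suc (m * 2)) 2)
                   (trans (cong (λ x → (2 + x) % 4) (*-assoc m 2 2)) ([m+kn]%n≡m%n 2 m 4))
                   (m*n/n≡m (suc (m * 2)) 2))

head-recurrence : ∀ r₂ r₄ previous halves {x} → head previous ≡ just x →
                  head (recurrence r₂ r₄ previous halves) ≡ just (addOne x)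
head-recurrence r₂ r₄ previous halves eq with r₂ ≡ᵇ 1 | r₄ ≡ᵇ 0
... | true  | _     = head-map-just addOne previous eq
... | false | true  = head-++ (map addOne previous) (map double halves) (head-map-just addOne previous eq)
... | false | false = head-++ (map addOne previous) (map double (reverse halves)) (head-map-just addOne previous eq)

head-𝓑list : ∀ n → head (𝓑list n) ≡ just (replicate n 0)
head-𝓑list zero    = refl
head-𝓑list (suc m) =
  trans (cong head (𝓑list-suc m))
        (trans (head-recurrence (suc m % 2) (suc m % 4) (𝓑list m) (𝓑list (suc m / 2)) (head-𝓑list m))
               (cong just (replicate-∷ʳ m 0)))

last-𝓑list-odd : ∀ m {X} → last (𝓑list (m * 2)) ≡ just X →
                 last (𝓑list (suc (m * 2))) ≡ just (addOne X)
last-𝓑list-odd m eq = trans (cong last (𝓑list-odd m)) (last-map-just addOne (𝓑list (m * 2)) eq)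

last-𝓑list-double : ∀ m {X} → last (𝓑list (m * 2)) ≡ just X →
                    last (𝓑list (m * 2 * 2)) ≡ just (double X)
last-𝓑list-double zero    refl = refl
last-𝓑list-double (suc m) eq =
  trans (cong last (𝓑list-4[1+m] m))
        (last-++ʳ (map addOne (𝓑list (suc (suc (suc (m * 2 * 2))))))
                  (last-map-just double (𝓑list (suc m * 2)) eq))

last-𝓑list-2[1+2m] : ∀ m → last (𝓑list (suc (m * 2) * 2)) ≡ just (replicate (suc (m * 2)) 1)
last-𝓑list-2[1+2m] m =
  trans (cong last (𝓑list-2[1+2m] m))
        (last-++ʳ (map addOne (𝓑list (suc (m * 2 * 2))))
          (trans (last-map-just double (reverse halves) (trans (last-reverse halves) (head-𝓑list (suc (m * 2)))))
                 (cong just (map-replicate suc (suc (m * 2)) 0))))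
  where halves = 𝓑list (suc (m * 2))

data OddCopies (b : ℕ) : Partition → Set where
  none   : OddCopies b []
  copies : ∀ r {c} → b ≤ c → OddCopies b (replicate (suc (r * 2)) c)

OddCopies-double : ∀ {b X} → OddCopies b X → OddCopies (suc b) (double X)
OddCopies-double none             = none
OddCopies-double (copies r {c} b≤c) =
  subst (OddCopies _) (sym (map-replicate suc (suc (r * 2)) c)) (copies r (s≤s b≤c))

OddCopies-weaken : ∀ {b X} → OddCopies (suc b) X → OddCopies b X
OddCopies-weaken none               = none
OddCopies-weaken (copies r sb≤c) = copies r (≤-trans (n≤1+n _) sb≤c)

last-𝓑list-even : ∀ m → ∃[ X ] last (𝓑list (m * 2)) ≡ just X × OddCopies 1 X
last-𝓑list-even = <-rec _ shape
  where
  shape : ∀ m → (∀ {k} → k < m → ∃[ X ] last (𝓑list (k * 2)) ≡ just X × OddCopies 1 X) →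
          ∃[ X ] last (𝓑list (m * 2)) ≡ just X × OddCopies 1 X
  shape m rec with evenOrOdd m
  ... | even zero    = [] , refl , none
  ... | even (suc k) with rec {suc k} (m<m*n (suc k) 2 (s≤s (s≤s z≤n)))
  ...   | X , eq , oc = double X , last-𝓑list-double (suc k) eq , OddCopies-weaken (OddCopies-double oc)
  shape m rec | odd k = replicate (suc (k * 2)) 1 , last-𝓑list-2[1+2m] k , copies k (s≤s z≤n)

count-++ : ∀ k xs ys → count k (xs ++ ys) ≡ count k xs + count k ys
count-++ k xs ys =
  trans (cong length (filter-++ (λ e → T? (e ≡ᵇ k)) xs ys)) (length-++ (filterᵇ (λ e → e ≡ᵇ k) xs))

count-double : ∀ k xs → count (suc k) (double xs) ≡ count k xs
count-double k xs =
  trans (cong length (filterᵇ-map (λ e → e ≡ᵇ suc k) suc xs)) (length-map suc (filterᵇ (λ e → e ≡ᵇ k) xs))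

count-zero-double : ∀ xs → count 0 (double xs) ≡ 0
count-zero-double []       = refl
count-zero-double (x ∷ xs) = count-zero-double xs

count-absent : ∀ k {xs} → All (_≢ k) xs → count k xs ≡ 0
count-absent k xs≢k =
  cong length (filter-none (λ e → T? (e ≡ᵇ k)) (All.map (λ e≢k t → e≢k (≡ᵇ⇒≡ _ k t)) xs≢k))

count-replicate : ∀ n c → count c (replicate n c) ≡ n
count-replicate n c =
  trans (cong length (filter-all (λ e → T? (e ≡ᵇ c)) (All.replicate⁺ n (≡⇒≡ᵇ c c refl)))) (length-replicate n)

maximum : List ℕ → ℕ
maximum = foldr _⊔_ 0

maximum-< : ∀ {c xs} → 0 < c → All (_< c) xs → maximum xs < c
maximum-< 0<c []           = 0<c
maximum-< 0<c (e<c ∷ xs<c) = ⊔-lub e<c (maximum-< 0<c xs<c)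

maximum-replicate-++ : ∀ n c xs → maximum xs ≤ c → maximum (replicate (suc n) c ++ xs) ≡ c
maximum-replicate-++ zero    c xs xs≤c = m≥n⇒m⊔n≡m xs≤c
maximum-replicate-++ (suc n) c xs xs≤c = trans (cong (c ⊔_) (maximum-replicate-++ n c xs xs≤c)) (⊔-idem c)

maximum-++ : ∀ xs ys → maximum (xs ++ ys) ≡ maximum xs ⊔ maximum ys
maximum-++ []       ys = refl
maximum-++ (x ∷ xs) ys = trans (cong (x ⊔_) (maximum-++ xs ys)) (sym (⊔-assoc x (maximum xs) (maximum ys)))

maximum-double : ∀ x xs → maximum (double (x ∷ xs)) ≡ suc (maximum (x ∷ xs))
maximum-double x []       = cong suc (sym (⊔-identityʳ x))
maximum-double x (y ∷ ys) = cong (suc x ⊔_) (maximum-double y ys)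

partsBelow : ℕ → Partition → List ℕ
partsBelow i = filterᵇ (λ e → (1 ≤ᵇ e) ∧ (e <ᵇ i))

partsBelow-1 : ∀ xs → partsBelow 1 xs ≡ []
partsBelow-1 xs =
  filter-none (λ e → T? ((1 ≤ᵇ e) ∧ (e <ᵇ 1))) (All.universal (λ { zero () ; (suc e) () }) xs)

below-at : ∀ P {i} → topExp P ≡ i → below P ≡ partsBelow i P
below-at P refl = refl

epsilon-at : ∀ P {xs} → below P ≡ xs → epsilon P ≡ signOf (length xs)
epsilon-at P refl = refl

topExp-double : ∀ x xs → topExp (double (x ∷ xs)) ≡ suc (maximum (x ∷ xs))
topExp-double x xs =
  trans (cong maximum (trans (filterᵇ-map (1 ≤ᵇ_) suc (x ∷ xs)) (cong double (filterᵇ-true (x ∷ xs)))))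
        (maximum-double x xs)

below-double : ∀ A {i} → topExp (double A) ≡ suc i → below (double A) ≡ double (filterᵇ (_<ᵇ i) A)
below-double A eq = trans (below-at (double A) eq) (filterᵇ-map _ suc A)

-- Moves

data Move : Set where
  split-at merge-at : ℕ → Move

apply : Move → Digits → Digits
apply (split-at p) = split p
apply (merge-at p) = merge p

shift : Move → Move
shift (split-at p) = split-at (suc p)
shift (merge-at p) = merge-at (suc p)

select : Bool → Bool → Bool → Bool → ℕ → ℕ → Move
select ε≡-σ dᵢ≡1 dᵢ-odd dⱼ≡1 i j =
  if ε≡-σ then (if dᵢ≡1 then split-at i else if dᵢ-odd then merge-at i else split-at i)
  else (if dᵢ-odd then (if dⱼ≡1 then split-at j else merge-at j) else merge-at i)

moveFor : Sign → Sign → ℕ → ℕ → ℕ → ℕ → Move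
moveFor σ ε i j dᵢ dⱼ = select (signEq ε (opposite σ)) (dᵢ ≡ᵇ 1) (isOdd dᵢ) (dⱼ ≡ᵇ 1) i j

move : Sign → Partition → Move
move σ P = moveFor σ (epsilon P) (topExp P) (secondExp P) (digits P (topExp P)) (digits P (secondExp P))

operation-move : ∀ σ P k → operation σ P k ≡ apply (move σ P) (digits P) k
operation-move σ P k =
  apply-select (signEq (epsilon P) (opposite σ)) (digits P (topExp P) ≡ᵇ 1) (isOdd (digits P (topExp P)))
               (digits P (secondExp P) ≡ᵇ 1)
  where
  D = digits P
  apply-select : ∀ b₁ b₂ b₃ b₄ →
    (if b₁ then (if b₂ then split (topExp P) D else (if b₃ then merge (topExp P) D else split (topExp P) D))
     else (if b₃ then (if b₄ then split (secondExp P) D else merge (secondExp P) D) else merge (topExp P) D)) k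
    ≡ apply (select b₁ b₂ b₃ b₄ (topExp P) (secondExp P)) D k
  apply-select true  true  _     _     = refl
  apply-select true  false true  _     = refl
  apply-select true  false false _     = refl
  apply-select false _     true  true  = refl
  apply-select false _     true  false = refl
  apply-select false _     false _     = refl

move-profile : ∀ σ P {ε i j dᵢ dⱼ} → epsilon P ≡ ε → topExp P ≡ i → secondExp P ≡ j →
               digits P i ≡ dᵢ → digits P j ≡ dⱼ → move σ P ≡ moveFor σ ε i j dᵢ dⱼ
move-profile σ P refl refl refl refl refl = refl

Removable : Move → Digits → Set
Removable (split-at p) D = 1 ≤ D p
Removable (merge-at p) D = 2 ≤ D p

-- neither consumes nor produces parts equal to 1
Even : Move → Set
Even (split-at p) = 2 ≤ p
Even (merge-at p) = 1 ≤ p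

-- y arises from x by the move m, up to parts equal to 1
record _⟶[_]_ (x : Partition) (m : Move) (y : Partition) : Set where
  constructor ⟨_,_⟩
  field
    removable : Removable m (digits x)
    result    : ∀ k → 1 ≤ k → apply m (digits x) k ≡ count k y

Removable-mono : ∀ m {D E : Digits} → (∀ p → D p ≤ E p) → Removable m D → Removable m E
Removable-mono (split-at p) D≤E r = ≤-trans r (D≤E p)
Removable-mono (merge-at p) D≤E r = ≤-trans r (D≤E p)

apply-cong : ∀ m {D E : Digits} k → D k ≡ E k → apply m D k ≡ apply m E k
apply-cong (split-at p) k = cong (λ d → (d + (if k ≡ᵇ (p ∸ 1) then 2 else 0)) ∸ (if k ≡ᵇ p then 1 else 0))
apply-cong (merge-at p) k = cong (λ d → (d + (if k ≡ᵇ suc p then 1 else 0)) ∸ (if k ≡ᵇ p then 2 else 0))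

removed≤ : ∀ (D : Digits) k p s a → s ≤ D p → (if k ≡ᵇ p then s else 0) ≤ D k + a
removed≤ D k p s a s≤Dp with k ≡ᵇ p in eq
... | false = z≤n
... | true rewrite ≡ᵇ⇒≡ k p (subst T (sym eq) tt) = ≤-trans s≤Dp (m≤m+n (D p) a)

+-+-∸-assoc : ∀ e d a s → s ≤ d + a → e + d + a ∸ s ≡ e + (d + a ∸ s)
+-+-∸-assoc e d a s h = trans (cong (_∸ s) (+-assoc e d a)) (+-∸-assoc e h)

apply-+ˡ : ∀ m (D E : Digits) k → Removable m D → apply m (λ i → E i + D i) k ≡ E k + apply m D k
apply-+ˡ (split-at p) D E k r = +-+-∸-assoc (E k) (D k) _ _ (removed≤ D k p 1 _ r)
apply-+ˡ (merge-at p) D E k r = +-+-∸-assoc (E k) (D k) _ _ (removed≤ D k p 2 _ r)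

⟶-spectator : ∀ R {x x′ y y′ m} → (∀ k → count k x′ ≡ count k R + count k x) →
              (∀ k → count k y′ ≡ count k R + count k y) → x ⟶[ m ] y → x′ ⟶[ m ] y′
⟶-spectator R {x} {x′} {y} {y′} {m} x′≡R+x y′≡R+y ⟨ r , x⟶y ⟩ =
  ⟨ Removable-mono m x≤x′ r , result ⟩
  where
  x≤x′ : ∀ p → digits x p ≤ digits x′ p
  x≤x′ zero    = ≤-refl
  x≤x′ (suc p) = subst (count (suc p) x ≤_) (sym (x′≡R+x (suc p))) (m≤n+m _ _)
  result : ∀ k → 1 ≤ k → apply m (digits x′) k ≡ count k y′
  result (suc k) _ = begin
    apply m (digits x′) (suc k)                        ≡⟨ apply-cong m (suc k) (x′≡R+x (suc k)) ⟩
    apply m (λ i → digits R i + digits x i) (suc k)    ≡⟨ apply-+ˡ m (digits x) (digits R) (suc k) r ⟩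
    count (suc k) R + apply m (digits x) (suc k)       ≡⟨ cong (count (suc k) R +_) (x⟶y (suc k) (s≤s z≤n)) ⟩
    count (suc k) R + count (suc k) y                  ≡⟨ y′≡R+y (suc k) ⟨
    count (suc k) y′                                   ∎
    where open ≡-Reasoning

⟶-++ˡ : ∀ R {x m y} → x ⟶[ m ] y → (R ++ x) ⟶[ m ] (R ++ y)
⟶-++ˡ R {x} {y = y} = ⟶-spectator R {x} {R ++ x} {y} {R ++ y} (λ k → count-++ k R x) (λ k → count-++ k R y)

⟶-++ʳ : ∀ R {x m y} → x ⟶[ m ] y → (x ++ R) ⟶[ m ] (y ++ R)
⟶-++ʳ R {x} {y = y} = ⟶-spectator R {x} {x ++ R} {y} {y ++ R}
  (λ k → trans (count-++ k x R) (+-comm (count k x) (count k R)))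
  (λ k → trans (count-++ k y R) (+-comm (count k y) (count k R)))

apply-shift : ∀ m (D : Digits) k → Even m → apply (shift m) D (suc k) ≡ apply m (λ i → D (suc i)) k
apply-shift (split-at (suc (suc p))) D k _ = refl
apply-shift (merge-at (suc p))       D k _ = refl
apply-shift (split-at 1)             D k (s≤s ())

apply-ones : ∀ m (D : Digits) → Even m → apply m D 0 ≡ D 0
apply-ones (split-at (suc (suc p))) D _ = +-identityʳ (D 0)
apply-ones (merge-at (suc p))       D _ = +-identityʳ (D 0)
apply-ones (split-at 1)             D (s≤s ())

Even-shift : ∀ m → Even m → Even (shift m)
Even-shift (split-at p) 2≤p = ≤-trans 2≤p (n≤1+n p)
Even-shift (merge-at p) _   = s≤s z≤n

⟶-double : ∀ {A B m} → Even m → double A ⟶[ m ] double B →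
           double (double A) ⟶[ shift m ] double (double B)
⟶-double {A} {B} {m} ev ⟨ r , A⟶B ⟩ = ⟨ removable m ev r , result ⟩
  where
  removable : ∀ m → Even m → Removable m (digits (double A)) →
              Removable (shift m) (digits (double (double A)))
  removable (split-at (suc (suc p))) _ r = subst (1 ≤_) (sym (count-double (suc (suc p)) (double A))) r
  removable (merge-at (suc p))       _ r = subst (2 ≤_) (sym (count-double (suc p) (double A))) r
  removable (split-at 1)             (s≤s ()) r
  no-twos : ∀ X → count 1 (double (double X)) ≡ 0
  no-twos X = trans (count-double 0 (double X)) (count-zero-double X)
  result : ∀ k → 1 ≤ k → apply (shift m) (digits (double (double A))) k ≡ count k (double (double B))
  result 1 _ = begin
    apply (shift m) (digits (double (double A))) 1          ≡⟨ apply-shift m _ 0 ev ⟩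
    apply m (λ i → digits (double (double A)) (suc i)) 0    ≡⟨ apply-ones m _ ev ⟩
    count 1 (double (double A))                             ≡⟨ trans (no-twos A) (sym (no-twos B)) ⟩
    count 1 (double (double B))                             ∎
    where open ≡-Reasoning
  result (suc (suc k)) _ = begin
    apply (shift m) (digits (double (double A))) (suc (suc k))   ≡⟨ apply-shift m _ (suc k) ev ⟩
    apply m (λ i → digits (double (double A)) (suc i)) (suc k)   ≡⟨ apply-cong m (suc k) (count-double (suc k) (double A)) ⟩
    apply m (digits (double A)) (suc k)                          ≡⟨ A⟶B (suc k) (s≤s z≤n) ⟩
    count (suc k) (double B)                                     ≡⟨ count-double (suc k) (double B) ⟨
    count (suc (suc k)) (double (double B))                      ∎
    where open ≡-Reasoning

move-stack : ∀ σ n {c ys} → 1 ≤ c → All (λ e → 1 ≤ e × e < c) ys →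
             move σ (replicate (suc n) c ++ ys) ≡
             moveFor σ (signOf (length ys)) c (maximum ys) (suc n) (digits ys (maximum ys))
move-stack σ n {suc c} {ys} _ inner =
  move-profile σ P (epsilon-at P below≡ys) top (cong maximum below≡ys) top-digit (lower-digits (maximum ys) max<c)
  where
  P = replicate (suc n) (suc c) ++ ys
  ys<c : All (_< suc c) ys
  ys<c = All.map proj₂ inner
  max<c : maximum ys < suc c
  max<c = maximum-< (s≤s z≤n) ys<c
  positive : All (λ e → T (1 ≤ᵇ e)) P
  positive = All.++⁺ (All.replicate⁺ (suc n) tt) (All.map (λ h → ≤⇒≤ᵇ (proj₁ h)) inner)
  top : topExp P ≡ suc c
  top = trans (cong maximum (filter-all (λ e → T? (1 ≤ᵇ e)) positive)) (maximum-replicate-++ n (suc c) ys (<⇒≤ max<c))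
  below≡ys : below P ≡ ys
  below≡ys = begin
    below P
      ≡⟨ below-at P top ⟩
    partsBelow (suc c) P
      ≡⟨ filter-++ inner? (replicate (suc n) (suc c)) ys ⟩
    partsBelow (suc c) (replicate (suc n) (suc c)) ++ partsBelow (suc c) ys
      ≡⟨ cong₂ _++_ no-top all-inner ⟩
    ys
      ∎
    where
    open ≡-Reasoning
    inner? = λ e → T? ((1 ≤ᵇ e) ∧ (e <ᵇ suc c))
    no-top = filter-none inner? (All.replicate⁺ {x = suc c} (suc n) (λ t → n≮n c (<ᵇ⇒< c c t)))
    all-inner = filter-all inner? (All.map (λ { (s≤s z≤n , e<c) → <⇒<ᵇ e<c }) inner)
  top-digit : digits P (suc c) ≡ suc n
  top-digit = trans (count-++ (suc c) (replicate (suc n) (suc c)) ys)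
                    (trans (cong₂ _+_ (count-replicate (suc n) (suc c)) (count-absent (suc c) (All.map <⇒≢ ys<c)))
                           (+-identityʳ (suc n)))
  lower-digits : ∀ j → j < suc c → digits P j ≡ digits ys j
  lower-digits zero    _   = refl
  lower-digits (suc j) j<c = trans (count-++ (suc j) (replicate (suc n) (suc c)) ys)
    (cong (_+ count (suc j) ys) (count-absent (suc j) (All.replicate⁺ (suc n) (λ c≡j → <⇒≢ j<c (sym c≡j)))))

moveFor-shift : ∀ σ ε i j dᵢ dⱼ → moveFor σ ε (suc i) (suc j) dᵢ dⱼ ≡ shift (moveFor σ ε i j dᵢ dⱼ)
moveFor-shift σ ε i j dᵢ dⱼ = select-shift (signEq ε (opposite σ)) (dᵢ ≡ᵇ 1) (isOdd dᵢ) (dⱼ ≡ᵇ 1)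
  where
  select-shift : ∀ b₁ b₂ b₃ b₄ → select b₁ b₂ b₃ b₄ (suc i) (suc j) ≡ shift (select b₁ b₂ b₃ b₄ i j)
  select-shift true  true  _     _     = refl
  select-shift true  false true  _     = refl
  select-shift true  false false _     = refl
  select-shift false _     true  true  = refl
  select-shift false _     true  false = refl
  select-shift false _     false _     = refl

-- with no second-largest part (j = 0, dⱼ = 2) the one move not commuting with shift is merge-at 0
moveFor-shift-0 : ∀ σ ε i dᵢ → Even (moveFor σ ε i 0 dᵢ 2) →
                  moveFor σ ε (suc i) 0 dᵢ 2 ≡ shift (moveFor σ ε i 0 dᵢ 2)
moveFor-shift-0 σ ε i dᵢ = select-shift (signEq ε (opposite σ)) (dᵢ ≡ᵇ 1) (isOdd dᵢ)
  where
  select-shift : ∀ b₁ b₂ b₃ → Even (select b₁ b₂ b₃ false i 0) →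
                 select b₁ b₂ b₃ false (suc i) 0 ≡ shift (select b₁ b₂ b₃ false i 0)
  select-shift true  true  _     _ = refl
  select-shift true  false true  _ = refl
  select-shift true  false false _ = refl
  select-shift false _     false _ = refl
  select-shift false _     true  ()

move-double : ∀ σ A → Even (move σ (double A)) → move σ (double (double A)) ≡ shift (move σ (double A))
move-double plus  [] ()
move-double minus [] ()
move-double σ A@(a ∷ A′) ev = by-lower-parts C refl
  where
  t  = maximum A
  P  = double A
  dᵢ = digits P (suc t)
  top : topExp P ≡ suc t
  top = topExp-double a A′
  top′ : topExp (double P) ≡ suc (suc t)
  top′ = trans (topExp-double (suc a) (double A′)) (cong suc (maximum-double a A′))
  C = filterᵇ (_<ᵇ t) A
  lower : below P ≡ double C
  lower = below-double A top
  lower′ : below (double P) ≡ double (double C)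
  lower′ = trans (below-double P top′) (cong double (filterᵇ-map (_<ᵇ suc t) suc A))
  sign : epsilon (double P) ≡ epsilon P
  sign = trans (epsilon-at (double P) lower′)
               (trans (cong signOf (length-map suc (double C))) (sym (epsilon-at P lower)))
  by-lower-parts : ∀ C′ → C ≡ C′ → move σ (double P) ≡ shift (move σ P)
  by-lower-parts [] C≡[] = begin
    move σ (double P)
      ≡⟨ move-profile σ (double P) sign top′ second′ (count-double (suc t) P) refl ⟩
    moveFor σ (epsilon P) (suc (suc t)) 0 dᵢ 2
      ≡⟨ moveFor-shift-0 σ (epsilon P) (suc t) dᵢ (subst Even profile ev) ⟩
    shift (moveFor σ (epsilon P) (suc t) 0 dᵢ 2)
      ≡⟨ cong shift profile ⟨
    shift (move σ P)
      ∎
    where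
    open ≡-Reasoning
    second′ = cong maximum (trans lower′ (cong (double ∘ double) C≡[]))
    profile = move-profile σ P refl top (cong maximum (trans lower (cong double C≡[]))) refl refl
  by-lower-parts (c ∷ cs) C≡c∷cs = begin
    move σ (double P)
      ≡⟨ move-profile σ (double P) sign top′ second′ (count-double (suc t) P) (count-double (suc j) P) ⟩
    moveFor σ (epsilon P) (suc (suc t)) (suc (suc j)) dᵢ dⱼ
      ≡⟨ moveFor-shift σ (epsilon P) (suc t) (suc j) dᵢ dⱼ ⟩
    shift (moveFor σ (epsilon P) (suc t) (suc j) dᵢ dⱼ)
      ≡⟨ cong shift profile ⟨
    shift (move σ P)
      ∎
    where
    open ≡-Reasoning
    j  = maximum (c ∷ cs)
    dⱼ = digits P (suc j)
    second′ : secondExp (double P) ≡ suc (suc j)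
    second′ = trans (cong maximum (trans lower′ (cong (double ∘ double) C≡c∷cs)))
                    (trans (maximum-double (suc c) (double cs)) (cong suc (maximum-double c cs)))
    second : secondExp P ≡ suc j
    second = trans (cong maximum (trans lower (cong double C≡c∷cs))) (maximum-double c cs)
    profile = move-profile σ P refl top second refl refl

-- all parts equal 2 (i = 1, j = 0): the only even move merges two of them, whatever the direction
moveFor-twos : ∀ σ (D : Digits) → Even (moveFor σ plus 1 0 (D 1) 2) → Removable (moveFor σ plus 1 0 (D 1) 2) D →
               moveFor (opposite σ) plus 1 0 (suc (D 1)) 2 ≡ moveFor σ plus 1 0 (D 1) 2
moveFor-twos plus D ev r rewrite isOdd-suc (D 1) with isOdd (D 1) | ev | r
... | true  | () | _
... | false | _  | 2≤d rewrite positive⇒≡ᵇ0-false (≤-trans (n≤1+n 1) 2≤d) = refl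
moveFor-twos minus D ev r rewrite isOdd-suc (D 1) with D 1 ≡ᵇ 1 | isOdd (D 1) | ev
... | true  | _     | s≤s ()
... | false | true  | _ = refl
... | false | false | s≤s ()

-- otherwise the added 2 lies below the top and only flips ε, which the opposite direction undoes
moveFor-append-two : ∀ σ l i j P P′ → (∀ k → count (suc k) P′ ≡ count (suc k) P + count (suc k) [ 1 ]) →
  Even (moveFor σ (signOf l) i j (digits P i) (digits P j)) →
  Removable (moveFor σ (signOf l) i j (digits P i) (digits P j)) (digits P) →
  moveFor (opposite σ) (signOf (suc l)) i (j ⊔ 1) (digits P i) (digits P′ (j ⊔ 1)) ≡
  moveFor σ (signOf l) i j (digits P i) (digits P j)
moveFor-append-two σ l i j P P′ P′≡P+2 ev r
  rewrite signOf-suc l | signEq-opposite (signOf l) σ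
  with signEq (signOf l) (opposite σ) | isOdd (digits P i)
... | true  | _     = refl
... | false | false = refl
... | false | true  = second j ev r
  where
  second : ∀ j → Even (if digits P j ≡ᵇ 1 then split-at j else merge-at j) →
           Removable (if digits P j ≡ᵇ 1 then split-at j else merge-at j) (digits P) →
           (if digits P′ (j ⊔ 1) ≡ᵇ 1 then split-at (j ⊔ 1) else merge-at (j ⊔ 1)) ≡
           (if digits P j ≡ᵇ 1 then split-at j else merge-at j)
  second zero () _
  second 1 ev r rewrite P′≡P+2 0 with count 1 P in d≡ | ev | r
  ... | suc (suc d) | _      | _ = refl
  ... | 1           | s≤s () | _
  ... | 0           | _      | 2≤d with subst (2 ≤_) d≡ 2≤d
  ...   | ()
  second (suc (suc j)) _ _ rewrite P′≡P+2 (suc j) | +-identityʳ (count (suc (suc j)) P) = refl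

move-append-two : ∀ σ A → Even (move σ (double A)) → Removable (move σ (double A)) (digits (double A)) →
                  move (opposite σ) (double A ++ [ 1 ]) ≡ move σ (double A)
move-append-two plus  [] ()
move-append-two minus [] ()
move-append-two σ A@(a ∷ A′) ev r = by-top (maximum A) refl
  where
  P  = double A
  P′ = P ++ [ 1 ]
  top : ∀ {t} → maximum A ≡ t → topExp P ≡ suc t
  top eq = trans (topExp-double a A′) (cong suc eq)
  top′ : ∀ {t} → maximum A ≡ t → topExp P′ ≡ suc t
  top′ eq = trans (cong topExp (sym (map-++ suc A [ 0 ])))
                  (trans (topExp-double a (A′ ++ [ 0 ]))
                         (cong suc (trans (maximum-++ A [ 0 ]) (trans (⊔-identityʳ _) eq))))
  by-top : ∀ t → maximum A ≡ t → move (opposite σ) P′ ≡ move σ P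
  by-top zero eq = begin
    move (opposite σ) P′
      ≡⟨ move-profile (opposite σ) P′ (epsilon-at P′ lower′) (top′ eq) (cong maximum lower′) d₁′ refl ⟩
    moveFor (opposite σ) plus 1 0 (suc d₁) 2
      ≡⟨ moveFor-twos σ (digits P) (subst Even profile ev) (subst (λ m → Removable m (digits P)) profile r) ⟩
    moveFor σ plus 1 0 d₁ 2
      ≡⟨ profile ⟨
    move σ P
      ∎
    where
    open ≡-Reasoning
    d₁ = digits P 1
    d₁′ : digits P′ 1 ≡ suc d₁
    d₁′ = trans (count-++ 1 P [ 1 ]) (+-comm d₁ 1)
    lower : below P ≡ []
    lower = trans (below-at P (top eq)) (partsBelow-1 P)
    lower′ : below P′ ≡ []
    lower′ = trans (below-at P′ (top′ eq)) (partsBelow-1 P′)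
    profile : move σ P ≡ moveFor σ plus 1 0 d₁ 2
    profile = move-profile σ P (epsilon-at P lower) (top eq) (cong maximum lower) refl refl
  by-top (suc t) eq = begin
    move (opposite σ) P′
      ≡⟨ move-profile (opposite σ) P′ sign′ (top′ eq) second′ dᵢ′ refl ⟩
    moveFor (opposite σ) (signOf (suc l)) i (j ⊔ 1) dᵢ dⱼ′
      ≡⟨ moveFor-append-two σ l i j P P′ (λ k → count-++ (suc k) P [ 1 ])
           (subst Even profile ev) (subst (λ m → Removable m (digits P)) profile r) ⟩
    moveFor σ (signOf l) i j dᵢ (digits P j)
      ≡⟨ profile ⟨
    move σ P
      ∎
    where
    open ≡-Reasoning
    i = suc (suc t)
    j = secondExp P
    l = length (below P)
    dᵢ = digits P i
    dⱼ′ = digits P′ (j ⊔ 1)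
    lower′ : below P′ ≡ below P ++ [ 1 ]
    lower′ = trans (below-at P′ (top′ eq))
                   (trans (filter-++ (λ e → T? ((1 ≤ᵇ e) ∧ (e <ᵇ i))) P [ 1 ])
                          (cong (_++ [ 1 ]) (sym (below-at P (top eq)))))
    sign′ : epsilon P′ ≡ signOf (suc l)
    sign′ = trans (epsilon-at P′ lower′) (cong signOf (trans (length-++ (below P)) (+-comm l 1)))
    second′ : secondExp P′ ≡ j ⊔ 1
    second′ = trans (cong maximum lower′) (maximum-++ (below P) [ 1 ])
    dᵢ′ : digits P′ i ≡ dᵢ
    dᵢ′ = trans (count-++ i P [ 1 ]) (+-identityʳ dᵢ)
    profile : move σ P ≡ moveFor σ (signOf l) i j dᵢ (digits P j)
    profile = move-profile σ P refl (top eq) refl refl refl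

-- Adjacent partitions

Step : Sign → Partition → Partition → Set
Step σ x y = ∀ k → 1 ≤ k → operation σ x k ≡ count k y

Adjacent : Sign → Partition → Partition → Set
Adjacent σ x y = Step σ x y × Step (opposite σ) y x

EvenStep : Sign → Partition → Partition → Set
EvenStep σ x y = Even (move σ x) × x ⟶[ move σ x ] y

EvenAdjacent : Sign → Partition → Partition → Set
EvenAdjacent σ x y = EvenStep σ x y × EvenStep (opposite σ) y x

⟶⇒Step : ∀ {σ x m y} → move σ x ≡ m → x ⟶[ m ] y → Step σ x y
⟶⇒Step {σ} {x} refl x⟶y k 1≤k = trans (operation-move σ x k) (_⟶[_]_.result x⟶y k 1≤k)

⟶⇒EvenStep : ∀ {σ x m y} → move σ x ≡ m → Even m → x ⟶[ m ] y → EvenStep σ x y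
⟶⇒EvenStep refl even-m x⟶y = even-m , x⟶y

EvenAdjacent⇒Adjacent : ∀ {σ x y} → EvenAdjacent σ x y → Adjacent σ x y
EvenAdjacent⇒Adjacent {σ} ((_ , x⟶y) , (_ , y⟶x)) = ⟶⇒Step {σ} refl x⟶y , ⟶⇒Step {opposite σ} refl y⟶x

EvenStep-double : ∀ {σ A B} → EvenStep σ (double A) (double B) →
                  EvenStep σ (double (double A)) (double (double B))
EvenStep-double {σ} {A} (ev , A⟶B) = ⟶⇒EvenStep (move-double σ A ev) (Even-shift _ ev) (⟶-double ev A⟶B)

EvenStep-append-two : ∀ {σ A B} → EvenStep σ (double A) (double B) →
                      EvenStep (opposite σ) (double A ++ [ 1 ]) (double B ++ [ 1 ])
EvenStep-append-two {σ} {A} (ev , A⟶B) =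
  ⟶⇒EvenStep (move-append-two σ A ev (_⟶[_]_.removable A⟶B)) ev (⟶-++ʳ [ 1 ] A⟶B)

EvenAdjacent-double : ∀ {σ A B} → EvenAdjacent σ (double A) (double B) →
                      EvenAdjacent σ (double (double A)) (double (double B))
EvenAdjacent-double (A→B , B→A) = EvenStep-double A→B , EvenStep-double B→A

EvenAdjacent-addOne : ∀ {σ A B} → EvenAdjacent σ (double A) (double B) →
                      EvenAdjacent (opposite σ) (double (addOne A)) (double (addOne B))
EvenAdjacent-addOne {A = A} {B} (A→B , B→A) =
  subst₂ (EvenAdjacent _) (sym (map-++ suc A [ 0 ])) (sym (map-++ suc B [ 0 ]))
         (EvenStep-append-two A→B , EvenStep-append-two B→A)

EvenAdjacent-flip : ∀ {σ x y} → EvenAdjacent σ x y → EvenAdjacent (opposite σ) y x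
EvenAdjacent-flip {σ} {x} {y} (x→y , y→x) =
  y→x , subst (λ τ → EvenStep τ x y) (sym (opposite-involutive σ)) x→y

twos⟶four : (1 ∷ 1 ∷ []) ⟶[ merge-at 1 ] [ 2 ]
twos⟶four = ⟨ ≤-refl , (λ { 1 _ → refl ; 2 _ → refl ; (suc (suc (suc k))) _ → refl }) ⟩

four⟶twos : [ 2 ] ⟶[ split-at 2 ] (1 ∷ 1 ∷ [])
four⟶twos = ⟨ ≤-refl , (λ { 1 _ → refl ; 2 _ → refl ; (suc (suc (suc k))) _ → refl }) ⟩

none⟶two : [] ⟶[ merge-at 0 ] [ 1 ]
none⟶two = ⟨ ≤-refl , (λ { 1 _ → refl ; (suc (suc k)) _ → refl }) ⟩

two⟶none : [ 1 ] ⟶[ split-at 1 ] []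
two⟶none = ⟨ ≤-refl , (λ { 1 _ → refl ; (suc (suc k)) _ → refl }) ⟩

twos⇄four-under : ∀ {R} → OddCopies 2 R → EvenAdjacent plus (R ++ 1 ∷ 1 ∷ []) (R ++ [ 2 ])
twos⇄four-under none =
  ⟶⇒EvenStep {plus} refl (s≤s z≤n) twos⟶four , ⟶⇒EvenStep {minus} refl (s≤s (s≤s z≤n)) four⟶twos
twos⇄four-under (copies r {suc (suc c)} (s≤s (s≤s _))) =
  ⟶⇒EvenStep merges (s≤s z≤n) (⟶-++ˡ R twos⟶four) , ⟶⇒EvenStep (splits c) (s≤s (s≤s z≤n)) (⟶-++ˡ R four⟶twos)
  where
  R = replicate (suc (r * 2)) (suc (suc c))
  merges : move plus (R ++ 1 ∷ 1 ∷ []) ≡ merge-at 1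
  two-twos = (s≤s z≤n , s≤s (s≤s z≤n)) ∷ (s≤s z≤n , s≤s (s≤s z≤n)) ∷ []
  merges = trans (move-stack plus (r * 2) (s≤s z≤n) two-twos)
                 (cong (λ b → if b then merge-at 1 else merge-at (suc (suc c))) (isOdd-odd r))
  splits : ∀ c → move minus (replicate (suc (r * 2)) (suc (suc c)) ++ [ 2 ]) ≡ split-at 2
  splits zero = trans (cong (move minus) (trans (replicate-∷ʳ (suc (r * 2)) 2) (sym (++-identityʳ _))))
                      (trans (move-stack minus (suc (r * 2)) (s≤s z≤n) [])
                             (cong (λ b → if b then merge-at 2 else split-at 2) (isOdd-even (suc r))))
  splits (suc c) = trans (move-stack minus (r * 2) (s≤s z≤n) ((s≤s z≤n , s≤s (s≤s (s≤s z≤n))) ∷ []))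
                         (cong (λ b → if b then split-at 2 else merge-at (suc (suc (suc c)))) (isOdd-odd r))

none⇄two-under : ∀ {R} → OddCopies 1 R → Adjacent plus R (R ++ [ 1 ])
none⇄two-under none = ⟶⇒Step {plus} refl none⟶two , ⟶⇒Step {minus} refl two⟶none
none⇄two-under (copies r {suc c} (s≤s _)) =
  ⟶⇒Step merges (subst (_⟶[ merge-at 0 ] (R ++ [ 1 ])) (++-identityʳ R) (⟶-++ˡ R none⟶two)) ,
  ⟶⇒Step (splits c) (subst ((R ++ [ 1 ]) ⟶[ split-at 1 ]_) (++-identityʳ R) (⟶-++ˡ R two⟶none))
  where
  R = replicate (suc (r * 2)) (suc c)
  merges : move plus R ≡ merge-at 0
  merges = trans (cong (move plus) (sym (++-identityʳ R)))
                 (trans (move-stack plus (r * 2) (s≤s z≤n) [])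
                        (cong (λ b → if b then merge-at 0 else merge-at (suc c)) (isOdd-odd r)))
  splits : ∀ c → move minus (replicate (suc (r * 2)) (suc c) ++ [ 1 ]) ≡ split-at 1
  splits zero = trans (cong (move minus) (trans (replicate-∷ʳ (suc (r * 2)) 1) (sym (++-identityʳ _))))
                      (trans (move-stack minus (suc (r * 2)) (s≤s z≤n) [])
                             (cong (λ b → if b then merge-at 1 else split-at 1) (isOdd-even (suc r))))
  splits (suc c) = trans (move-stack minus (r * 2) (s≤s z≤n) ((s≤s z≤n , s≤s (s≤s z≤n)) ∷ []))
                         (cong (λ b → if b then split-at 1 else merge-at (suc (suc c))) (isOdd-odd r))

twos⇄four : ∀ {Y} → OddCopies 1 Y → EvenAdjacent plus (double (addOne (addOne Y))) (double (Y ++ [ 1 ]))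
twos⇄four {Y} oc =
  subst₂ (EvenAdjacent plus) (sym x≡) (sym (map-++ suc Y [ 1 ])) (twos⇄four-under (OddCopies-double oc))
  where
  x≡ : double (addOne (addOne Y)) ≡ double Y ++ 1 ∷ 1 ∷ []
  x≡ = trans (map-++ suc (Y ++ [ 0 ]) [ 0 ])
             (trans (cong (_++ [ 1 ]) (map-++ suc Y [ 0 ])) (++-assoc (double Y) [ 1 ] [ 1 ]))

none⇄two : ∀ {Y} → OddCopies 0 Y → Adjacent plus (double Y) (double (addOne Y))
none⇄two {Y} oc =
  subst (Adjacent plus (double Y)) (sym (map-++ suc Y [ 0 ])) (none⇄two-under (OddCopies-double oc))

-- 𝓑(n), doubled, is a chain

Chain : Sign → List Partition → Set
Chain σ Bs = Linked (EvenAdjacent σ) (map double Bs)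

chain-map : ∀ {σ τ} (f : Partition → Partition) →
            (∀ {A B} → EvenAdjacent σ (double A) (double B) → EvenAdjacent τ (double (f A)) (double (f B))) →
            ∀ {Bs} → Chain σ Bs → Chain τ (map f Bs)
chain-map f g {Bs} l = subst (Linked _) (map-∘ Bs) (Linked.map⁺ (Linked.map g (Linked.map⁻ l)))

chain-reverse : ∀ {σ Bs} → Chain σ Bs → Chain (opposite σ) (reverse Bs)
chain-reverse {Bs = Bs} l =
  subst (Linked _) (sym (reverse-map double Bs)) (Linked.map EvenAdjacent-flip (Linked-reverse l))

chain-++ : ∀ {σ} Xs Ys → Chain σ Xs → Connected (EvenAdjacent σ) (last (map double Xs)) (head (map double Ys)) →
           Chain σ Ys → Chain σ (Xs ++ Ys)
chain-++ Xs Ys l₁ c l₂ = subst (Linked _) (sym (map-++ double Xs Ys)) (Linked.++⁺ l₁ c l₂)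

𝓑list-chain-odd : ∀ {σ} m → Chain σ (𝓑list (m * 2)) → Chain (opposite σ) (𝓑list (suc (m * 2)))
𝓑list-chain-odd m c = subst (Chain _) (sym (𝓑list-odd m)) (chain-map addOne EvenAdjacent-addOne c)

𝓑list-chain-4[1+m] : ∀ k → Chain minus (𝓑list (suc (suc (suc (k * 2 * 2))))) → Chain plus (𝓑list (suc k * 2)) →
                     Chain plus (𝓑list (suc k * 2 * 2))
𝓑list-chain-4[1+m] k c₁ c₂ =
  subst (Chain plus) (sym (𝓑list-4[1+m] k))
        (chain-++ (map addOne B₁) (map double B₂) (chain-map addOne EvenAdjacent-addOne c₁) junction
                  (chain-map double EvenAdjacent-double c₂))
  where
  B₁ = 𝓑list (suc (suc (suc (k * 2 * 2))))
  B₂ = 𝓑list (suc k * 2)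
  junction : Connected (EvenAdjacent plus) (last (map double (map addOne B₁))) (head (map double (map double B₂)))
  junction =
    connect (map double (map addOne B₁)) (map double (map double B₂))
      (last-map-just double (map addOne B₁) (last-map-just addOne B₁ (last-𝓑list-odd (suc (k * 2)) (last-𝓑list-2[1+2m] k))))
      (trans (head-map-just double (map double B₂) (head-map-just double B₂ (head-𝓑list (suc k * 2))))
             (cong (just ∘ double) (trans (map-replicate suc (suc k * 2) 0) (sym (replicate-∷ʳ (suc (k * 2)) 1)))))
      (twos⇄four (copies k ≤-refl))

𝓑list-chain-2[1+2m] : ∀ k → Chain minus (𝓑list (suc (k * 2 * 2))) → Chain minus (𝓑list (suc (k * 2))) →
                      Chain plus (𝓑list (suc (k * 2) * 2))
𝓑list-chain-2[1+2m] k c₁ c₂ =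
  subst (Chain plus) (sym (𝓑list-2[1+2m] k))
        (chain-++ (map addOne B₁) (map double (reverse B₂)) (chain-map addOne EvenAdjacent-addOne c₁) junction
                  (chain-map double EvenAdjacent-double (chain-reverse c₂)))
  where
  B₁ = 𝓑list (suc (k * 2 * 2))
  B₂ = 𝓑list (suc (k * 2))
  X = proj₁ (last-𝓑list-even k)
  last≡X = proj₁ (proj₂ (last-𝓑list-even k))
  junction : Connected (EvenAdjacent plus) (last (map double (map addOne B₁))) (head (map double (map double (reverse B₂))))
  junction =
    connect (map double (map addOne B₁)) (map double (map double (reverse B₂)))
      (last-map-just double (map addOne B₁) (last-map-just addOne B₁ (last-𝓑list-odd (k * 2) (last-𝓑list-double k last≡X))))
      (trans (head-map-just double (map double (reverse B₂))
               (head-map-just double (reverse B₂) (trans (head-reverse B₂) (last-𝓑list-odd k last≡X))))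
             (cong (just ∘ double) (map-++ suc X [ 0 ])))
      (twos⇄four (OddCopies-weaken (OddCopies-double (proj₂ (proj₂ (last-𝓑list-even k))))))

orientation : ℕ → Sign
orientation zero    = plus
orientation (suc n) = opposite (orientation n)

orientation-even : ∀ m → orientation (m * 2) ≡ plus
orientation-even zero = refl
orientation-even (suc m) rewrite orientation-even m = refl

at-even : ∀ m {Bs} → Chain (orientation (m * 2)) Bs → Chain plus Bs
at-even m {Bs} = subst (λ σ → Chain σ Bs) (orientation-even m)

at-odd : ∀ m {Bs} → Chain (orientation (suc (m * 2))) Bs → Chain minus Bs
at-odd m {Bs} = subst (λ σ → Chain σ Bs) (cong opposite (orientation-even m))

𝓑list-chain : ∀ n → Chain (orientation n) (𝓑list n)
𝓑list-chain = <-rec (λ n → Chain (orientation n) (𝓑list n)) chain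
  where
  chain : ∀ n → (∀ {m} → m < n → Chain (orientation m) (𝓑list m)) → Chain (orientation n) (𝓑list n)
  chain n rec with evenOrOdd n
  ... | odd m = 𝓑list-chain-odd m (rec ≤-refl)
  ... | even m with evenOrOdd m
  ...   | even zero    = [-]
  ...   | even (suc k) = subst (λ σ → Chain σ (𝓑list (suc k * 2 * 2))) (sym (orientation-even (suc k * 2)))
                           (𝓑list-chain-4[1+m] k (at-odd (suc (k * 2)) (rec ≤-refl))
                                                 (at-even (suc k) (rec (m<m*n (suc k * 2) 2 (s≤s (s≤s z≤n))))))
  ...   | odd k        = subst (λ σ → Chain σ (𝓑list (suc (k * 2) * 2))) (sym (orientation-even (suc (k * 2))))
                           (𝓑list-chain-2[1+2m] k (at-odd (k * 2) (rec ≤-refl))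
                                                  (at-odd k (rec (m<m*n (suc (k * 2)) 2 (s≤s (s≤s z≤n))))))

-- The sequence 𝓑

hasOne-addOne : ∀ A → hasOne (addOne A) ≡ true
hasOne-addOne []      = refl
hasOne-addOne (e ∷ A) with e ≡ᵇ 0
... | true  = refl
... | false = hasOne-addOne A

hasOne-double : ∀ A → hasOne (double A) ≡ false
hasOne-double []      = refl
hasOne-double (e ∷ A) = hasOne-double A

filter-no-ones : ∀ Xs Ys → filterᵇ (not ∘ hasOne) (map addOne Xs ++ map double Ys) ≡ map double Ys
filter-no-ones Xs Ys = trans (filter-++ even? (map addOne Xs) (map double Ys)) (cong₂ _++_ drop-odd keep-even)
  where
  even? = λ P → T? (not (hasOne P))
  drop-odd = filter-none even? (All.map⁺ (All.universal (λ A → subst (T ∘ not) (hasOne-addOne A)) Xs))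
  keep-even = filter-all even? (All.map⁺ (All.universal (λ A → subst (T ∘ not) (sym (hasOne-double A)) tt) Ys))

block-even : ∀ k → block (k * 2) ≡ map double (𝓑list (k * 2))
block-even zero    = refl
block-even (suc k) =
  trans (cong (filterᵇ (not ∘ hasOne) ∘ 𝓑list) (*-comm 2 (suc k * 2)))
        (trans (cong (filterᵇ (not ∘ hasOne)) (𝓑list-4[1+m] k))
               (filter-no-ones (𝓑list (suc (suc (suc (k * 2 * 2))))) (𝓑list (suc k * 2))))

block-odd : ∀ k → block (suc (k * 2)) ≡ map double (reverse (𝓑list (suc (k * 2))))
block-odd k =
  trans (cong (filterᵇ (not ∘ hasOne) ∘ 𝓑list) (*-comm 2 (suc (k * 2))))
        (trans (cong (filterᵇ (not ∘ hasOne)) (𝓑list-2[1+2m] k))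
               (filter-no-ones (𝓑list (suc (k * 2 * 2))) (reverse (𝓑list (suc (k * 2))))))

block-chain : ∀ m → Linked (Adjacent plus) (block m)
block-chain m with evenOrOdd m
... | even k = subst (Linked (Adjacent plus)) (sym (block-even k))
                     (Linked.map EvenAdjacent⇒Adjacent (at-even k (𝓑list-chain (k * 2))))
... | odd k  = subst (Linked (Adjacent plus)) (sym (block-odd k))
                     (Linked.map EvenAdjacent⇒Adjacent (chain-reverse (at-odd k (𝓑list-chain (suc (k * 2))))))

last-block-even : ∀ k → last (block (k * 2)) ≡ just (double (proj₁ (last-𝓑list-even k)))
last-block-even k =
  trans (cong last (block-even k)) (last-map-just double (𝓑list (k * 2)) (proj₁ (proj₂ (last-𝓑list-even k))))

last-block-odd : ∀ k → last (block (suc (k * 2))) ≡ just (double (replicate (suc (k * 2)) 0))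
last-block-odd k = trans (cong last (block-odd k))
  (last-map-just double (reverse B) (trans (last-reverse B) (head-𝓑list (suc (k * 2)))))
  where B = 𝓑list (suc (k * 2))

head-block-even : ∀ k → head (block (k * 2)) ≡ just (double (replicate (k * 2) 0))
head-block-even k = trans (cong head (block-even k)) (head-map-just double (𝓑list (k * 2)) (head-𝓑list (k * 2)))

head-block-odd : ∀ k → head (block (suc (k * 2))) ≡ just (double (addOne (proj₁ (last-𝓑list-even k))))
head-block-odd k = trans (cong head (block-odd k))
  (head-map-just double (reverse B) (trans (head-reverse B) (last-𝓑list-odd k (proj₁ (proj₂ (last-𝓑list-even k))))))
  where B = 𝓑list (suc (k * 2))

block-junction : ∀ t → Connected (Adjacent plus) (last (block t)) (head (block (suc t)))
block-junction t with evenOrOdd t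
... | even k = connect (block (k * 2)) (block (suc (k * 2))) (last-block-even k) (head-block-odd k)
                       (none⇄two (OddCopies-weaken (proj₂ (proj₂ (last-𝓑list-even k)))))
... | odd k  = connect (block (suc (k * 2))) (block (suc k * 2)) (last-block-odd k)
                       (trans (head-block-even (suc k)) (cong (just ∘ double) (sym (replicate-∷ʳ (suc (k * 2)) 0))))
                       (none⇄two (copies k z≤n))

last-block : ∀ t → ∃[ x ] last (block t) ≡ just x
last-block t with evenOrOdd t
... | even k = _ , last-block-even k
... | odd k  = _ , last-block-odd k

prefix-suc : ∀ t → prefix (suc t) ≡ prefix t ++ block (suc t)
prefix-suc t = begin
  concatMap block (upTo (suc (suc t)))               ≡⟨ cong (concatMap block) (applyUpTo-∷ʳ id (suc t)) ⟨
  concatMap block (upTo (suc t) ++ [ suc t ])        ≡⟨ concatMap-++ block (upTo (suc t)) [ suc t ] ⟩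
  prefix t ++ block (suc t) ++ []                    ≡⟨ cong (prefix t ++_) (++-identityʳ (block (suc t))) ⟩
  prefix t ++ block (suc t)                          ∎
  where open ≡-Reasoning

last-prefix : ∀ t → last (prefix t) ≡ last (block t)
last-prefix zero    = refl
last-prefix (suc t) = trans (cong last (prefix-suc t)) (trans (last-++ʳ (prefix t) last≡) (sym last≡))
  where last≡ = proj₂ (last-block (suc t))

prefix-chain : ∀ t → Linked (Adjacent plus) (prefix t)
prefix-chain zero    = [-]
prefix-chain (suc t) = subst (Linked (Adjacent plus)) (sym (prefix-suc t))
  (Linked.++⁺ (prefix-chain t)
               (subst (λ x → Connected (Adjacent plus) x (head (block (suc t)))) (sym (last-prefix t)) (block-junction t))
               (block-chain (suc t)))

length-prefix : ∀ t → suc t ≤ length (prefix t)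
length-prefix zero    = s≤s z≤n
length-prefix (suc t) = subst (suc (suc t) ≤_) (sym (trans (cong length (prefix-suc t)) (length-++ (prefix t))))
  (subst (_≤ length (prefix t) + length (block (suc t))) (+-comm (suc t) 1)
         (+-mono-≤ (length-prefix t) (nonempty (block (suc t)) (proj₂ (last-block (suc t))))))
  where nonempty : ∀ xs {x} → last xs ≡ just x → 1 ≤ length xs
        nonempty (_ ∷ _) _ = s≤s z≤n

𝓑seq-adjacent : ∀ t → Adjacent plus (𝓑seq (suc t)) (𝓑seq (suc (suc t)))
𝓑seq-adjacent t = subst (λ x → Adjacent plus x (𝓑seq (suc (suc t)))) same-position
  (Linked-nthOr [] t (prefix-chain (suc (suc t))) (≤-trans (n≤1+n _) (length-prefix (suc (suc t)))))
  where
  same-position : nthOr [] (prefix (suc (suc t))) t ≡ 𝓑seq (suc t)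
  same-position = trans (cong (λ xs → nthOr [] xs t) (prefix-suc (suc t)))
                        (nthOr-++ [] (prefix (suc t)) (block (suc (suc t))) t (≤-trans (n≤1+n _) (length-prefix (suc t))))

theorem2 : ((t : ℕ) → 1 ≤ t → (k : ℕ) → 1 ≤ k →
              operation plus (𝓑seq t) k ≡ count k (𝓑seq (suc t)))
           × ((t : ℕ) → 2 ≤ t → (k : ℕ) → 1 ≤ k →
              operation minus (𝓑seq t) k ≡ count k (𝓑seq (pred t)))
theorem2 = (λ { (suc t) _ → proj₁ (𝓑seq-adjacent t) })
         , (λ { (suc (suc t)) _ → proj₂ (𝓑seq-adjacent t) ; (suc zero) (s≤s ()) })
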